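{- Let $\mathbb{K}$ be a field, $n \in \mathbb{N}$, $\lambda \in \mathbb{N}_0^n$, and let $f, g, h \in \mathbb{K}[x_1,\ldots,x_n]$ with $f = gh$. Then: (1) If $g$ and $h$ are $\lambda$-lacunary, then $f$ is $\lambda$-lacunary. (2) If $f$ and $g$ are $\lambda$-lacunary, then $h$ is $\lambda$-lacunary.
   Context: For $\lambda = (\lambda_1,\ldots,\lambda_n) \in \mathbb{N}_0^n$, a polynomial $g \in \mathbb{K}[x_1,\ldots,x_n]$ is called $\lambda$-lacunary if it contains (with nonzero coefficient) a monomial $x^\mu = x_1^{\mu_1}\cdots x_n^{\mu_n}$ such that for every monomial $x^\nu$ appearing in $g$ with nonzero coefficient and for every $i \in \{1,\ldots,n\}$ we have $\nu_i < \mu_i - \lambda_i$ or $\nu_i = \mu_i$. (In particular the zero polynomial is not $\lambda$-lacunary.) -}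

module Defs where

open import Level using (Level; _⊔_; suc)
open import Algebra.Bundles using (CommutativeRing)
open import Data.Nat as ℕ using (ℕ; _∸_; _<_)
open import Data.Fin using (Fin)
open import Data.Vec using (Vec; zipWith; lookup)
open import Data.Vec.Properties using (≡-dec)
open import Data.List using (List; []; _∷_; concatMap; map)
open import Data.Product using (_×_; _,_; ∃; Σ)
open import Data.Sum using (_⊎_)
open import Relation.Nullary using (¬_; yes; no)
open import Relation.Binary.PropositionalEquality using (_≡_)

record Field (c ℓ : Level) : Set (suc (c ⊔ ℓ)) where
  field
    commutativeRing : CommutativeRing c ℓ
  open CommutativeRing commutativeRing public
  field
    0≉1     : ¬ (0# ≈ 1#)
    inverse : ∀ x → ¬ (x ≈ 0#) → Σ Carrier (λ y → (x * y) ≈ 1#)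

module Poly {c ℓ : Level} (K : Field c ℓ) (n : ℕ) where
  open Field K

  Exp : Set
  Exp = Vec ℕ n

  -- A polynomial in K[x₁,…,xₙ] is represented by a finite list of terms
  -- (coefficient, exponent); its coefficient at a monomial is the sum of
  -- the coefficients of all terms with that exponent.  Two lists denote the
  -- same polynomial iff all coefficients agree (up to ≈).
  Polynomial : Set c
  Polynomial = List (Carrier × Exp)

  coeff : Polynomial → Exp → Carrier
  coeff []             μ = 0#
  coeff ((a , ν) ∷ ts) μ with ≡-dec ℕ._≟_ ν μ
  ... | yes _ = a + coeff ts μ
  ... | no  _ = coeff ts μ

  _*P_ : Polynomial → Polynomial → Polynomial
  g *P h = concatMap (λ { (a , μ) → map (λ { (b , ν) → (a * b , zipWith ℕ._+_ μ ν) }) h }) g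

  _≈P_ : Polynomial → Polynomial → Set ℓ
  f ≈P g = ∀ μ → coeff f μ ≈ coeff g μ

  Occurs : Polynomial → Exp → Set ℓ
  Occurs g μ = ¬ (coeff g μ ≈ 0#)

  Lacunary : Vec ℕ n → Polynomial → Set ℓ
  Lacunary lam g =
    ∃ λ (μ : Exp) → Occurs g μ ×
      (∀ (ν : Exp) → Occurs g ν → ∀ (i : Fin n) →
         (lookup ν i < lookup μ i ∸ lookup lam i) ⊎ (lookup ν i ≡ lookup μ i))

{-# OPTIONS --safe #-}

-- Every exponent of a λ-lacunary polynomial lies componentwise below its distinguished
-- exponent, and the gap condition is additive.
-- (1) If μ, ν are the distinguished exponents of g, h, then μ + ν has only the trivial
-- decomposition into exponents of g and h, so its coefficient in gh is g_μ h_ν ≠ 0; every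
-- exponent of gh is a sum of exponents of g and h, so it satisfies the gap condition
-- relative to μ + ν.
-- (2) Let κ, μ be the distinguished exponents of gh and g. Suppose some exponent ν′ of h
-- makes μ + ν′ violate the gap condition relative to κ, and take ν′ maximal among those.
-- In any decomposition ν + ν″ = μ + ν′ we have ν ≤ μ, so ν″ ≥ ν′, and the gap condition of g
-- makes μ + ν″ violate the condition too; by maximality ν″ = ν′. So μ + ν′ occurs in gh,
-- contradicting the lacunarity of gh. Hence all μ + ν′ satisfy the gap condition relative
-- to κ, which forces κ − μ to occur in h and to be its distinguished exponent.
-- Equality in K is undecidable, so case distinctions on vanishing coefficients are made in
-- the double-negation monad; this suffices because occurrence is a negative statement and
-- the gap condition is decidable.
module Submission where

open import Defs
open import Level using (Level)
open import Data.Nat using (ℕ)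
open import Data.Vec using (Vec)
open import Data.Product using (_×_; _,_)

module GapArithmetic where
  open import Data.Nat using (suc; _+_; _∸_; _≤_; _<_; _≟_; _<?_)
  open import Data.Nat.Properties
    using ( ≤-refl; ≤-trans; ≤-antisym; <⇒≤; m∸n≤m; m∸n≢0⇒n<m; m<n⇒n≢0
          ; m≤o∸n⇒m+n≤o; m+n≤o⇒m≤o∸n; m+n∸m≡n; +-assoc; +-comm
          ; +-cancelˡ-≡; +-cancelˡ-<; +-cancelˡ-≤; +-cancelʳ-≤
          ; +-monoˡ-≤; +-monoˡ-<; +-monoʳ-<; +-mono-<-≤; +-commutativeSemigroup; module ≤-Reasoning)
  open import Data.Sum using (_⊎_; inj₁; inj₂)
  open import Relation.Nullary.Decidable using (Dec; _⊎-dec_)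
  open import Relation.Binary.PropositionalEquality using (_≡_; refl; sym; trans; cong; subst)
  open import Algebra.Properties.CommutativeSemigroup +-commutativeSemigroup using (xy∙z≈xz∙y)
  open ≤-Reasoning

  Gap : ℕ → ℕ → ℕ → Set
  Gap l m v = v < m ∸ l ⊎ v ≡ m

  Gap? : ∀ l m v → Dec (Gap l m v)
  Gap? l m v = v <? m ∸ l ⊎-dec v ≟ m

  Gap⇒≤ : ∀ l {m v} → Gap l m v → v ≤ m
  Gap⇒≤ l {m} (inj₁ v<m∸l) = ≤-trans (<⇒≤ v<m∸l) (m∸n≤m m l)
  Gap⇒≤ l (inj₂ refl) = ≤-refl

  <∸⇒+< : ∀ {a b} l → a < b ∸ l → a + l < b
  <∸⇒+< {a} l a<b∸l = m≤o∸n⇒m+n≤o (suc a) (<⇒≤ (m∸n≢0⇒n<m (m<n⇒n≢0 a<b∸l))) a<b∸l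

  +<⇒<∸ : ∀ {a b l} → a + l < b → a < b ∸ l
  +<⇒<∸ {a} = m+n≤o⇒m≤o∸n (suc a)

  Gap-+ : ∀ l {a b c d} → Gap l b a → Gap l d c → Gap l (b + d) (a + c)
  Gap-+ l {a} {b} {c} {d} (inj₁ a<b∸l) c-gap = inj₁ (+<⇒<∸ (begin-strict
    a + c + l  ≡⟨ xy∙z≈xz∙y a c l ⟩
    a + l + c  <⟨ +-mono-<-≤ (<∸⇒+< l a<b∸l) (Gap⇒≤ l c-gap) ⟩
    b + d      ∎))
  Gap-+ l {a} {c = c} {d} (inj₂ refl) (inj₁ c<d∸l) = inj₁ (+<⇒<∸ (begin-strict
    a + c + l    ≡⟨ +-assoc a c l ⟩
    a + (c + l)  <⟨ +-monoʳ-< a (<∸⇒+< l c<d∸l) ⟩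
    a + d        ∎))
  Gap-+ l (inj₂ refl) (inj₂ refl) = inj₂ refl

  Gap-partner : ∀ l {m a c s k} → Gap l m a → a + c ≡ m + s → Gap l k (m + c) → Gap l k (m + s)
  Gap-partner l {m} {c = c} {s} {k} (inj₂ refl) m+c≡m+s c-gap =
    subst (λ x → Gap l k (m + x)) (+-cancelˡ-≡ m c s m+c≡m+s) c-gap
  Gap-partner l {m} {a} {c} {s} {k} (inj₁ a<m∸l) a+c≡m+s c-gap = inj₁ (+<⇒<∸ (begin-strict
    m + s + l    ≡⟨ +-assoc m s l ⟩
    m + (s + l)  <⟨ +-monoʳ-< m s+l<c ⟩
    m + c        ≤⟨ Gap⇒≤ l c-gap ⟩
    k            ∎))
    where
      s+l<c : s + l < c
      s+l<c = +-cancelˡ-< a (s + l) c (begin-strict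
        a + (s + l)  ≡⟨ cong (a +_) (+-comm s l) ⟩
        a + (l + s)  ≡⟨ +-assoc a l s ⟨
        a + l + s    <⟨ +-monoˡ-< s (<∸⇒+< l a<m∸l) ⟩
        m + s        ≡⟨ a+c≡m+s ⟨
        a + c        ∎)

  Gap-∸ : ∀ l {k} m {v} → Gap l k (m + v) → Gap l (k ∸ m) v
  Gap-∸ l {k} m {v} (inj₁ m+v<k∸l) = inj₁ (+<⇒<∸ (+<⇒<∸ (begin-strict
    v + l + m    ≡⟨ +-comm (v + l) m ⟩
    m + (v + l)  ≡⟨ +-assoc m v l ⟨
    m + v + l    <⟨ <∸⇒+< l m+v<k∸l ⟩
    k            ∎)))
  Gap-∸ l m {v} (inj₂ m+v≡k) = inj₂ (trans (sym (m+n∸m≡n m v)) (cong (_∸ m) m+v≡k))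

  m≤n⇒m+o≡n+p⇒p≤o : ∀ {m n o p} → m ≤ n → m + o ≡ n + p → p ≤ o
  m≤n⇒m+o≡n+p⇒p≤o {m} {n} {o} {p} m≤n m+o≡n+p = +-cancelˡ-≤ n p o (begin
    n + p  ≡⟨ m+o≡n+p ⟨
    m + o  ≤⟨ +-monoˡ-≤ o m≤n ⟩
    n + o  ∎)

  m≤n⇒m+o≡p⇒n+o≤p⇒o≡p∸n : ∀ {m n o p} → m ≤ n → m + o ≡ p → n + o ≤ p → o ≡ p ∸ n
  m≤n⇒m+o≡p⇒n+o≤p⇒o≡p∸n {m} {n} {o} m≤n refl n+o≤m+o
    with refl ← ≤-antisym m≤n (+-cancelʳ-≤ o n m n+o≤m+o) = sym (m+n∸m≡n m o)

module ExponentVectors where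
  open import Data.Nat using (z≤n; _+_; _∸_; _≤_; _<_; _≟_)
  open import Data.Nat.Properties
    using (≤-antisym; +-cancelʳ-≡; +-mono-≤; +-mono-<-≤; +-monoʳ-<; ≤∧≢⇒<; ∸-monoʳ-<)
  open import Data.Nat.Induction using (<-wellFounded)
  open import Data.Vec using ([]; _∷_; lookup; zipWith; sum)
  open import Data.Vec.Properties using (lookup-zipWith; ≡-dec)
  open import Data.Vec.Relation.Binary.Pointwise.Extensional
    using (Pointwise; ext; head; tail; Pointwise-≡⇒≡)
  open import Data.Product using (∃)
  open import Data.Empty using (⊥-elim)
  open import Function using (_∘_)
  open import Induction.WellFounded using (Acc; acc)
  open import Relation.Nullary using (¬_; yes; no)
  open import Relation.Binary.PropositionalEquality
    using (_≡_; _≢_; refl; sym; trans; cong; subst; subst₂)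
  open Pointwise
  open GapArithmetic

  private
    variable
      n : ℕ
      a : Level

  infixl 6 _⊕_ _∸ᵉ_
  infix 4 _≤ᵉ_

  _⊕_ : Vec ℕ n → Vec ℕ n → Vec ℕ n
  _⊕_ = zipWith _+_

  _∸ᵉ_ : Vec ℕ n → Vec ℕ n → Vec ℕ n
  _∸ᵉ_ = zipWith _∸_

  _≤ᵉ_ : Vec ℕ n → Vec ℕ n → Set
  _≤ᵉ_ = Pointwise _≤_

  lookup-⊕ : ∀ (u v : Vec ℕ n) i → lookup (u ⊕ v) i ≡ lookup u i + lookup v i
  lookup-⊕ u v i = lookup-zipWith _+_ i u v

  ⊕-≡⇒+-≡ : ∀ {u u′ v v′ : Vec ℕ n} → u ⊕ v ≡ u′ ⊕ v′ →
             ∀ i → lookup u i + lookup v i ≡ lookup u′ i + lookup v′ i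
  ⊕-≡⇒+-≡ {u = u} {u′} {v} {v′} eq i =
    trans (sym (lookup-⊕ u v i)) (trans (cong (λ w → lookup w i) eq) (lookup-⊕ u′ v′ i))

  ≤ᵉ-antisym : {u v : Vec ℕ n} → u ≤ᵉ v → v ≤ᵉ u → u ≡ v
  ≤ᵉ-antisym u≤v v≤u = Pointwise-≡⇒≡ (ext λ i → ≤-antisym (app u≤v i) (app v≤u i))

  ⊕-cancelʳ : ∀ {u v w : Vec ℕ n} → u ⊕ w ≡ v ⊕ w → u ≡ v
  ⊕-cancelʳ {w = w} eq = Pointwise-≡⇒≡ (ext λ i → +-cancelʳ-≡ (lookup w i) _ _ (⊕-≡⇒+-≡ eq i))

  ⊕-≤ᵉ-swap : ∀ {u u′ v v′ : Vec ℕ n} → u ≤ᵉ u′ → u ⊕ v ≡ u′ ⊕ v′ → v′ ≤ᵉ v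
  ⊕-≤ᵉ-swap u≤u′ eq = ext λ i → m≤n⇒m+o≡n+p⇒p≤o (app u≤u′ i) (⊕-≡⇒+-≡ eq i)

  ⊕-≤ᵉ-unique : ∀ {u u′ v v′ : Vec ℕ n} → u ≤ᵉ u′ → v ≤ᵉ v′ → u ⊕ v ≡ u′ ⊕ v′ → u ≡ u′ × v ≡ v′
  ⊕-≤ᵉ-unique u≤u′ v≤v′ eq with refl ← ≤ᵉ-antisym v≤v′ (⊕-≤ᵉ-swap u≤u′ eq) = ⊕-cancelʳ eq , refl

  ⊕-≡-∸ᵉ : ∀ {u u′ v w : Vec ℕ n} → u ≤ᵉ u′ → u ⊕ v ≡ w → u′ ⊕ v ≤ᵉ w → v ≡ w ∸ᵉ u′
  ⊕-≡-∸ᵉ {u = u} {u′} {v} {w} u≤u′ refl u′+v≤w = Pointwise-≡⇒≡ (ext λ i →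
    trans (m≤n⇒m+o≡p⇒n+o≤p⇒o≡p∸n (app u≤u′ i) (sym (lookup-⊕ u v i))
                                  (subst (_≤ _) (lookup-⊕ u′ v i) (app u′+v≤w i)))
          (sym (lookup-zipWith _∸_ i w u′)))

  sum-mono-≤ᵉ : {u v : Vec ℕ n} → u ≤ᵉ v → sum u ≤ sum v
  sum-mono-≤ᵉ {u = []} {[]} _ = z≤n
  sum-mono-≤ᵉ {u = _ ∷ _} {_ ∷ _} u≤v = +-mono-≤ (head u≤v) (sum-mono-≤ᵉ (tail u≤v))

  sum-mono-<ᵉ : {u v : Vec ℕ n} → u ≤ᵉ v → u ≢ v → sum u < sum v
  sum-mono-<ᵉ {u = []} {[]} _ u≢v = ⊥-elim (u≢v refl)
  sum-mono-<ᵉ {u = x ∷ _} {y ∷ _} u≤v u≢v with x ≟ y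
  ... | yes refl = +-monoʳ-< x (sum-mono-<ᵉ (tail u≤v) (u≢v ∘ cong (x ∷_)))
  ... | no x≢y = +-mono-<-≤ (≤∧≢⇒< (head u≤v) x≢y) (sum-mono-≤ᵉ (tail u≤v))

  GapPattern : Vec ℕ n → Vec ℕ n → Vec ℕ n → Set
  GapPattern lam μ ν = ∀ i → Gap (lookup lam i) (lookup μ i) (lookup ν i)

  GapPattern⇒≤ᵉ : ∀ (lam : Vec ℕ n) {μ ν} → GapPattern lam μ ν → ν ≤ᵉ μ
  GapPattern⇒≤ᵉ lam gaps = ext λ i → Gap⇒≤ (lookup lam i) (gaps i)

  GapPattern-⊕ : ∀ {lam μ μ′ ν ν′ : Vec ℕ n} → GapPattern lam μ ν → GapPattern lam μ′ ν′ →
                 GapPattern lam (μ ⊕ μ′) (ν ⊕ ν′)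
  GapPattern-⊕ {lam = lam} {μ} {μ′} {ν} {ν′} gaps gaps′ i =
    subst₂ (Gap (lookup lam i)) (sym (lookup-⊕ μ μ′ i)) (sym (lookup-⊕ ν ν′ i))
      (Gap-+ (lookup lam i) (gaps i) (gaps′ i))

  GapPattern-∸ᵉ : ∀ {lam κ μ ν : Vec ℕ n} → GapPattern lam κ (μ ⊕ ν) → GapPattern lam (κ ∸ᵉ μ) ν
  GapPattern-∸ᵉ {lam = lam} {κ} {μ} {ν} gaps i =
    subst (λ t → Gap (lookup lam i) t (lookup ν i)) (sym (lookup-zipWith _∸_ i κ μ))
      (Gap-∸ (lookup lam i) (lookup μ i)
        (subst (Gap (lookup lam i) (lookup κ i)) (lookup-⊕ μ ν i) (gaps i)))

  Maximal : (Vec ℕ n → Set a) → Vec ℕ n → Set a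
  Maximal P ν = P ν × (∀ {ν′} → P ν′ → ν ≤ᵉ ν′ → ν′ ≡ ν)

  bounded⇒¬¬maximal : (P : Vec ℕ n → Set a) (B : ℕ) → (∀ {ν} → P ν → sum ν ≤ B) →
                      ∀ {ν} → P ν → ¬ ¬ ∃ (Maximal P)
  bounded⇒¬¬maximal P B bounded {ν} = go ν (<-wellFounded (B ∸ sum ν))
    where
      go : ∀ ν → Acc _<_ (B ∸ sum ν) → P ν → ¬ ¬ ∃ (Maximal P)
      go ν (acc rs) Pν noMaximal = noMaximal (ν , Pν , maximal)
        where
          maximal : ∀ {ν′} → P ν′ → ν ≤ᵉ ν′ → ν′ ≡ ν
          maximal {ν′} Pν′ ν≤ν′ with ≡-dec _≟_ ν′ ν
          ... | yes ν′≡ν = ν′≡ν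
          ... | no ν′≢ν = ⊥-elim (go ν′ (rs measure-decreases) Pν′ noMaximal)
            where
              measure-decreases : B ∸ sum ν′ < B ∸ sum ν
              measure-decreases = ∸-monoʳ-< (sum-mono-<ᵉ ν≤ν′ (ν′≢ν ∘ sym)) (bounded Pν′)

module ProductSupport {c ℓ : Level} (K : Field c ℓ) (n : ℕ) where
  open Field K
  open Poly K n
  open ExponentVectors
  open import Data.Nat using (_≤_; _<_; _≟_)
  open import Data.Nat.Properties using (≤-trans; m≤m+n; m≤n+m)
  open import Data.Nat.Induction using (<-wellFounded)
  open import Data.List using ([]; _∷_; _++_; map; length; filter)
  import Data.Nat.ListAction as ListAction
  open import Data.List.Properties using (filter-notAll)
  open import Data.List.Relation.Unary.Any using (here)
  open import Data.Vec using (sum)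
  open import Data.Vec.Properties using (≡-dec)
  open import Data.Product using (∃₂; proj₁; proj₂; uncurry)
  open import Function using (_∘_)
  open import Induction.WellFounded using (Acc; acc)
  open import Effect.Monad using (RawMonad)
  open import Relation.Nullary using (¬_; Dec; yes; no; ¬?)
  open import Relation.Nullary.Decidable using (¬¬-excluded-middle)
  open import Relation.Nullary.Negation using (¬¬-Monad; ¬¬-map; contradiction)
  open import Relation.Binary.PropositionalEquality as ≡ using (_≡_; _≢_)
  open import Algebra.Properties.CommutativeSemigroup +-commutativeSemigroup using (x∙yz≈y∙xz)
  open import Relation.Binary.Reasoning.Setoid setoid
  open RawMonad (¬¬-Monad {ℓ})

  -- `≡-dec _≟_` is spelled out, as in `coeff`, so that `with` abstracts the same term.
  δ : Exp → Exp → Carrier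
  δ ρ ν with ≡-dec _≟_ ν ρ
  ... | yes _ = 1#
  ... | no _ = 0#

  δ-refl : ∀ ρ → δ ρ ρ ≈ 1#
  δ-refl ρ with ≡-dec _≟_ ρ ρ
  ... | yes _ = refl
  ... | no ρ≢ρ = contradiction ≡.refl ρ≢ρ

  δ-≢ : ∀ {ρ ν} → ν ≢ ρ → δ ρ ν ≈ 0#
  δ-≢ {ρ} {ν} ν≢ρ with ≡-dec _≟_ ν ρ
  ... | yes ν≡ρ = contradiction ν≡ρ ν≢ρ
  ... | no _ = refl

  ⟪_,_⟫ : Polynomial → (Exp → Carrier) → Carrier
  ⟪ [] , H ⟫ = 0#
  ⟪ (a , ν) ∷ g , H ⟫ = a * H ν + ⟪ g , H ⟫

  coeff≈⟪δ⟫ : ∀ g ρ → coeff g ρ ≈ ⟪ g , δ ρ ⟫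
  coeff≈⟪δ⟫ [] ρ = refl
  coeff≈⟪δ⟫ ((a , ν) ∷ g) ρ with ≡-dec _≟_ ν ρ
  ... | yes _ = +-cong (sym (*-identityʳ a)) (coeff≈⟪δ⟫ g ρ)
  ... | no _ = sym (trans (+-cong (zeroʳ a) (sym (coeff≈⟪δ⟫ g ρ))) (+-identityˡ _))

  ⟪⟫-++ : ∀ g g′ {H} → ⟪ g ++ g′ , H ⟫ ≈ ⟪ g , H ⟫ + ⟪ g′ , H ⟫
  ⟪⟫-++ [] g′ = sym (+-identityˡ _)
  ⟪⟫-++ ((a , ν) ∷ g) g′ = trans (+-cong refl (⟪⟫-++ g g′)) (sym (+-assoc _ _ _))

  -- F stands for the pattern lambda inside _*P_, which cannot be named outside Defs.
  ⟪⟫-map-scaled : ∀ {a μ} (F : Carrier × Exp → Carrier × Exp) →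
                  (∀ b ν → F (b , ν) ≡ (a * b , μ ⊕ ν)) →
                  ∀ h {H} → ⟪ map F h , H ⟫ ≈ a * ⟪ h , H ∘ (μ ⊕_) ⟫
  ⟪⟫-map-scaled {a} F F-scales [] = sym (zeroʳ a)
  ⟪⟫-map-scaled {a} {μ} F F-scales ((b , ν) ∷ h) {H} rewrite F-scales b ν = begin
    a * b * H (μ ⊕ ν) + ⟪ map F h , H ⟫
      ≈⟨ +-cong (*-assoc a b _) (⟪⟫-map-scaled F F-scales h) ⟩
    a * (b * H (μ ⊕ ν)) + a * ⟪ h , H ∘ (μ ⊕_) ⟫
      ≈⟨ distribˡ a _ _ ⟨
    a * (b * H (μ ⊕ ν) + ⟪ h , H ∘ (μ ⊕_) ⟫)
      ∎

  ⟪⟫-*P : ∀ g h {H} → ⟪ g *P h , H ⟫ ≈ ⟪ g , (λ ν → ⟪ h , H ∘ (ν ⊕_) ⟫) ⟫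
  ⟪⟫-*P [] h = refl
  ⟪⟫-*P ((a , μ) ∷ g) h =
    trans (⟪⟫-++ (map _ h) (g *P h)) (+-cong (⟪⟫-map-scaled _ (λ _ _ → ≡.refl) h) (⟪⟫-*P g h))

  coeff-*P : ∀ g h ρ → coeff (g *P h) ρ ≈ ⟪ g , (λ ν → ⟪ h , δ ρ ∘ (ν ⊕_) ⟫) ⟫
  coeff-*P g h ρ = trans (coeff≈⟪δ⟫ (g *P h) ρ) (⟪⟫-*P g h)

  exponent≢? : ∀ μ (t : Carrier × Exp) → Dec (proj₂ t ≢ μ)
  exponent≢? μ (_ , ν) = ¬? (≡-dec _≟_ ν μ)

  remove : Exp → Polynomial → Polynomial
  remove μ = filter (exponent≢? μ)

  remove-shorter : ∀ a μ g → length (remove μ ((a , μ) ∷ g)) < length ((a , μ) ∷ g)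
  remove-shorter a μ g = filter-notAll (exponent≢? μ) ((a , μ) ∷ g) (here (λ μ≢μ → μ≢μ ≡.refl))

  coeff-∷-≢ : ∀ {a ν μ} g → ν ≢ μ → coeff ((a , ν) ∷ g) μ ≈ coeff g μ
  coeff-∷-≢ {ν = ν} {μ} g ν≢μ with ≡-dec _≟_ ν μ
  ... | yes ν≡μ = contradiction ν≡μ ν≢μ
  ... | no _ = refl

  coeff-∷-cong : ∀ {a ν μ} g g′ → coeff g μ ≈ coeff g′ μ →
                 coeff ((a , ν) ∷ g) μ ≈ coeff ((a , ν) ∷ g′) μ
  coeff-∷-cong {ν = ν} {μ} g g′ g≈g′ with ≡-dec _≟_ ν μ
  ... | yes _ = +-cong refl g≈g′
  ... | no _ = g≈g′

  coeff-remove-self : ∀ μ g → coeff (remove μ g) μ ≈ 0#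
  coeff-remove-self μ [] = refl
  coeff-remove-self μ ((a , ν) ∷ g) with ≡-dec _≟_ ν μ
  ... | yes _ = coeff-remove-self μ g
  ... | no ν≢μ = trans (coeff-∷-≢ (remove μ g) ν≢μ) (coeff-remove-self μ g)

  coeff-remove-other : ∀ μ g {ν} → ν ≢ μ → coeff (remove μ g) ν ≈ coeff g ν
  coeff-remove-other μ [] ν≢μ = refl
  coeff-remove-other μ ((a , ν₁) ∷ g) ν≢μ with ≡-dec _≟_ ν₁ μ
  ... | yes ≡.refl = trans (coeff-remove-other μ g ν≢μ) (sym (coeff-∷-≢ g (ν≢μ ∘ ≡.sym)))
  ... | no _ = coeff-∷-cong {a} {ν₁} (remove μ g) g (coeff-remove-other μ g ν≢μ)

  remove-support : ∀ μ g {ν} → Occurs (remove μ g) ν → ν ≢ μ × Occurs g ν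
  remove-support μ g {ν} ν∈g∖μ with ≡-dec _≟_ ν μ
  ... | yes ≡.refl = contradiction (coeff-remove-self μ g) ν∈g∖μ
  ... | no ν≢μ = ν≢μ , ν∈g∖μ ∘ trans (coeff-remove-other μ g ν≢μ)

  ⟪⟫-split : ∀ μ g {H} → ⟪ g , H ⟫ ≈ coeff g μ * H μ + ⟪ remove μ g , H ⟫
  ⟪⟫-split μ [] = sym (trans (+-identityʳ _) (zeroˡ _))
  ⟪⟫-split μ ((a , ν) ∷ g) {H} with ≡-dec _≟_ ν μ
  ... | yes ≡.refl = begin
    a * H ν + ⟪ g , H ⟫                                ≈⟨ +-cong refl (⟪⟫-split ν g) ⟩
    a * H ν + (coeff g ν * H ν + ⟪ remove ν g , H ⟫)   ≈⟨ +-assoc _ _ _ ⟨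
    a * H ν + coeff g ν * H ν + ⟪ remove ν g , H ⟫     ≈⟨ +-cong (distribʳ (H ν) a (coeff g ν)) refl ⟨
    (a + coeff g ν) * H ν + ⟪ remove ν g , H ⟫         ∎
  ... | no _ = trans (+-cong refl (⟪⟫-split μ g)) (x∙yz≈y∙xz _ _ _)

  ¬¬-zero-product : ∀ {x y} → (¬ x ≈ 0# → ¬ ¬ y ≈ 0#) → ¬ ¬ x * y ≈ 0#
  ¬¬-zero-product {x} {y} y-vanishes = ¬¬-excluded-middle >>= λ where
    (yes x≈0) → pure (trans (*-congʳ x≈0) (zeroˡ y))
    (no x≉0) → ¬¬-map (λ y≈0 → trans (*-congˡ y≈0) (zeroʳ x)) (y-vanishes x≉0)

  -- All terms with the head exponent are split off at once: a single term may be
  -- nonzero although the coefficient of its exponent vanishes.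
  ⟪⟫-vanishes : ∀ g {H} → (∀ {ν} → Occurs g ν → ¬ ¬ H ν ≈ 0#) → ¬ ¬ ⟪ g , H ⟫ ≈ 0#
  ⟪⟫-vanishes g = go g (<-wellFounded (length g))
    where
      go : ∀ g {H} → Acc _<_ (length g) → (∀ {ν} → Occurs g ν → ¬ ¬ H ν ≈ 0#) → ¬ ¬ ⟪ g , H ⟫ ≈ 0#
      go [] _ _ = pure refl
      go g@((a , ν) ∷ g′) {H} (acc rs) H-vanishes = do
        head≈0 ← ¬¬-zero-product H-vanishes
        rest≈0 ← go (remove ν g) (rs (remove-shorter a ν g′))
                    (H-vanishes ∘ proj₂ ∘ remove-support ν g)
        pure (begin
          ⟪ g , H ⟫                                ≈⟨ ⟪⟫-split ν g ⟩
          coeff g ν * H ν + ⟪ remove ν g , H ⟫     ≈⟨ +-cong head≈0 rest≈0 ⟩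
          0# + 0#                                  ≈⟨ +-identityʳ 0# ⟩
          0#                                       ∎)

  ⟪⟫-single : ∀ g {H} μ → (∀ {ν} → ν ≢ μ → Occurs g ν → ¬ ¬ H ν ≈ 0#) →
              ¬ ¬ ⟪ g , H ⟫ ≈ coeff g μ * H μ
  ⟪⟫-single g {H} μ H-vanishes = do
    rest≈0 ← ⟪⟫-vanishes (remove μ g) (uncurry H-vanishes ∘ remove-support μ g)
    pure (begin
      ⟪ g , H ⟫                                ≈⟨ ⟪⟫-split μ g ⟩
      coeff g μ * H μ + ⟪ remove μ g , H ⟫     ≈⟨ +-cong refl rest≈0 ⟩
      coeff g μ * H μ + 0#                     ≈⟨ +-identityʳ _ ⟩
      coeff g μ * H μ                          ∎)

  *-nonzero : ∀ {x y} → ¬ x ≈ 0# → ¬ y ≈ 0# → ¬ x * y ≈ 0#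
  *-nonzero {x} {y} x≉0 y≉0 xy≈0 with inverse x x≉0
  ... | x⁻¹ , xx⁻¹≈1 = y≉0 (begin
    y                ≈⟨ *-identityˡ y ⟨
    1# * y           ≈⟨ *-congʳ xx⁻¹≈1 ⟨
    x * x⁻¹ * y      ≈⟨ *-congʳ (*-comm x x⁻¹) ⟩
    x⁻¹ * x * y      ≈⟨ *-assoc x⁻¹ x y ⟩
    x⁻¹ * (x * y)    ≈⟨ *-congˡ xy≈0 ⟩
    x⁻¹ * 0#         ≈⟨ zeroʳ x⁻¹ ⟩
    0#               ∎)

  Decomposition : Polynomial → Polynomial → Exp → Set ℓ
  Decomposition g h ρ = ∃₂ λ ν ν′ → Occurs g ν × Occurs h ν′ × ν ⊕ ν′ ≡ ρ

  support-*P : ∀ g h {ρ} → Occurs (g *P h) ρ → ¬ ¬ Decomposition g h ρ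
  support-*P g h {ρ} ρ∈gh noDecomposition =
    ¬¬-map (trans (coeff-*P g h ρ)) (⟪⟫-vanishes g λ {ν} ν∈g → ⟪⟫-vanishes h λ {ν′} ν′∈h →
      pure (δ-≢ (λ ν⊕ν′≡ρ → noDecomposition (ν , ν′ , ν∈g , ν′∈h , ν⊕ν′≡ρ)))) ρ∈gh

  UniqueDecomposition : Polynomial → Polynomial → Exp → Exp → Set ℓ
  UniqueDecomposition g h μ ν =
    ∀ {μ′ ν′} → Occurs g μ′ → Occurs h ν′ → μ′ ⊕ ν′ ≡ μ ⊕ ν → μ′ ≡ μ × ν′ ≡ ν

  unique-decomposition⇒occurs : ∀ g h {μ ν} → Occurs g μ → Occurs h ν →
                                UniqueDecomposition g h μ ν → Occurs (g *P h) (μ ⊕ ν)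
  unique-decomposition⇒occurs g h {μ} {ν} μ∈g ν∈h unique coeff≈0 =
    coeff≈product λ coeff≈μν → *-nonzero μ∈g ν∈h (trans (sym coeff≈μν) coeff≈0)
    where
      coeff≈product : ¬ ¬ coeff (g *P h) (μ ⊕ ν) ≈ coeff g μ * coeff h ν
      coeff≈product = do
        outer ← ⟪⟫-single g μ λ μ′≢μ μ′∈g → ⟪⟫-vanishes h λ ν′∈h →
          pure (δ-≢ (μ′≢μ ∘ proj₁ ∘ unique μ′∈g ν′∈h))
        inner ← ⟪⟫-single h ν λ ν′≢ν ν′∈h →
          pure (δ-≢ (ν′≢ν ∘ proj₂ ∘ unique μ∈g ν′∈h))
        pure (begin
          coeff (g *P h) (μ ⊕ ν)                           ≈⟨ coeff-*P g h (μ ⊕ ν) ⟩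
          ⟪ g , (λ μ′ → ⟪ h , δ (μ ⊕ ν) ∘ (μ′ ⊕_) ⟫) ⟫     ≈⟨ outer ⟩
          coeff g μ * ⟪ h , δ (μ ⊕ ν) ∘ (μ ⊕_) ⟫           ≈⟨ *-congˡ inner ⟩
          coeff g μ * (coeff h ν * δ (μ ⊕ ν) (μ ⊕ ν))      ≈⟨ *-congˡ (*-congˡ (δ-refl (μ ⊕ ν))) ⟩
          coeff g μ * (coeff h ν * 1#)                     ≈⟨ *-congˡ (*-identityʳ _) ⟩
          coeff g μ * coeff h ν                            ∎)

  Occurs-resp-≈P : ∀ {f f′ ν} → f ≈P f′ → Occurs f ν → Occurs f′ ν
  Occurs-resp-≈P {ν = ν} f≈f′ ν∈f = ν∈f ∘ trans (f≈f′ ν)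

  degreeBound : Polynomial → ℕ
  degreeBound = ListAction.sum ∘ map (sum ∘ proj₂)

  occurs⇒sum≤degreeBound : ∀ g {ν} → Occurs g ν → sum ν ≤ degreeBound g
  occurs⇒sum≤degreeBound [] ν∈[] = contradiction refl ν∈[]
  occurs⇒sum≤degreeBound ((a , ν₁) ∷ g) {ν} ν∈g with ≡-dec _≟_ ν₁ ν
  ... | yes ≡.refl = m≤m+n (sum ν) (degreeBound g)
  ... | no _ = ≤-trans (occurs⇒sum≤degreeBound g ν∈g) (m≤n+m _ (sum ν₁))

module Lacunarity {c ℓ : Level} (K : Field c ℓ) (n : ℕ) where
  open Field K
  open Poly K n
  open GapArithmetic using (Gap; Gap?; Gap-partner)
  open ExponentVectors
  open ProductSupport K n
  open import Data.Vec using (lookup)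
  open import Data.Product using (∃; proj₁)
  open import Function using (_∘_)
  open import Effect.Monad using (RawMonad)
  open import Relation.Nullary using (¬_)
  open import Relation.Nullary.Decidable using (decidable-stable)
  open import Relation.Nullary.Negation using (¬¬-Monad; ¬¬-map)
  open import Relation.Binary.PropositionalEquality as ≡ using (_≡_)
  open RawMonad (¬¬-Monad {ℓ})

  Lacunary-resp-≈P : ∀ lam f f′ → f ≈P f′ → Lacunary lam f → Lacunary lam f′
  Lacunary-resp-≈P lam f f′ f≈f′ (μ , μ∈f , gaps) =
    μ , Occurs-resp-≈P {f} {f′} f≈f′ μ∈f ,
    λ ν ν∈f′ → gaps ν (Occurs-resp-≈P {f′} {f} (sym ∘ f≈f′) ν∈f′)

  UpperBound : Polynomial → Exp → Set ℓ
  UpperBound g μ = ∀ {ν} → Occurs g ν → ν ≤ᵉ μ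

  gaps⇒UpperBound : ∀ lam g μ → (∀ ν → Occurs g ν → GapPattern lam μ ν) → UpperBound g μ
  gaps⇒UpperBound lam g μ gaps {ν} ν∈g = GapPattern⇒≤ᵉ lam (gaps ν ν∈g)

  shifted-maximal-occurs : ∀ g h {μ} → Occurs g μ → UpperBound g μ → (W : Exp → Set) →
    (∀ {ν ν* ν″} → Occurs g ν → W ν* → ν ⊕ ν″ ≡ μ ⊕ ν* → W ν″) →
    ∀ {ν′} → Occurs h ν′ → W ν′ → ¬ ¬ ∃ λ ν* → W ν* × Occurs (g *P h) (μ ⊕ ν*)
  shifted-maximal-occurs g h {μ} μ∈g μ-bound W W-closed ν′∈h Wν′ = do
    ν* , (ν*∈h , Wν*) , maximal ← bounded⇒¬¬maximal (λ ν → Occurs h ν × W ν) (degreeBound h)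
                                    (occurs⇒sum≤degreeBound h ∘ proj₁) (ν′∈h , Wν′)
    pure (ν* , Wν* , unique-decomposition⇒occurs g h μ∈g ν*∈h λ {ν} ν∈g ν″∈h ν⊕ν″≡μ⊕ν* →
      let ν″≡ν* = maximal (ν″∈h , W-closed ν∈g Wν* ν⊕ν″≡μ⊕ν*) (⊕-≤ᵉ-swap (μ-bound ν∈g) ν⊕ν″≡μ⊕ν*)
      in ⊕-cancelʳ (≡.subst (λ ν″ → ν ⊕ ν″ ≡ μ ⊕ ν*) ν″≡ν* ν⊕ν″≡μ⊕ν*) , ν″≡ν*)

  lacunary-*P : ∀ lam g h → Lacunary lam g → Lacunary lam h → Lacunary lam (g *P h)
  lacunary-*P lam g h (μ , μ∈g , μ-gaps) (ν , ν∈h , ν-gaps) = μ ⊕ ν , μν∈gh , μν-gaps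
    where
      μν∈gh : Occurs (g *P h) (μ ⊕ ν)
      μν∈gh = unique-decomposition⇒occurs g h μ∈g ν∈h λ μ′∈g ν′∈h →
        ⊕-≤ᵉ-unique (gaps⇒UpperBound lam g μ μ-gaps μ′∈g) (gaps⇒UpperBound lam h ν ν-gaps ν′∈h)

      μν-gaps : ∀ ρ → Occurs (g *P h) ρ → GapPattern lam (μ ⊕ ν) ρ
      μν-gaps ρ ρ∈gh i = decidable-stable (Gap? (lookup lam i) (lookup (μ ⊕ ν) i) (lookup ρ i))
                           (¬¬-map gap-at-i (support-*P g h ρ∈gh))
        where
          gap-at-i : Decomposition g h ρ → Gap (lookup lam i) (lookup (μ ⊕ ν) i) (lookup ρ i)
          gap-at-i (μ′ , ν′ , μ′∈g , ν′∈h , ≡.refl) =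
            GapPattern-⊕ {lam = lam} {μ} {ν} {μ′} {ν′} (μ-gaps μ′ μ′∈g) (ν-gaps ν′ ν′∈h) i

  lacunary-cancelˡ : ∀ lam g h → Lacunary lam (g *P h) → Lacunary lam g → Lacunary lam h
  lacunary-cancelˡ lam g h (κ , κ∈gh , κ-gaps) (μ , μ∈g , μ-gaps) =
    κ ∸ᵉ μ , τ∈h , λ ν′ ν′∈h → GapPattern-∸ᵉ {lam = lam} {κ} {μ} {ν′} (shifted-gaps ν′∈h)
    where
      μ-bound : UpperBound g μ
      μ-bound = gaps⇒UpperBound lam g μ μ-gaps

      shifted-gaps : ∀ {ν′} → Occurs h ν′ → GapPattern lam κ (μ ⊕ ν′)
      shifted-gaps {ν′} ν′∈h i = decidable-stable (Gap? (lookup lam i) (lookup κ i) (lookup (μ ⊕ ν′) i))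
        λ no-gap → shifted-maximal-occurs g h μ∈g μ-bound W W-closed ν′∈h no-gap
                     λ (ν* , no-gap* , μν*∈gh) → no-gap* (κ-gaps _ μν*∈gh i)
        where
          G : ℕ → Set
          G = Gap (lookup lam i) (lookup κ i)

          W : Exp → Set
          W ν = ¬ G (lookup (μ ⊕ ν) i)

          W-closed : ∀ {ν ν* ν″} → Occurs g ν → W ν* → ν ⊕ ν″ ≡ μ ⊕ ν* → W ν″
          W-closed {ν} {ν*} {ν″} ν∈g no-gap* ν⊕ν″≡μ⊕ν* gap″ =
            no-gap* (≡.subst G (≡.sym (lookup-⊕ μ ν* i))
              (Gap-partner (lookup lam i) (μ-gaps ν ν∈g i) (⊕-≡⇒+-≡ ν⊕ν″≡μ⊕ν* i)
                (≡.subst G (lookup-⊕ μ ν″ i) gap″)))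

      τ∈h : Occurs h (κ ∸ᵉ μ)
      τ∈h coeff≈0 = support-*P g h κ∈gh λ (ν , ν′ , ν∈g , ν′∈h , ν⊕ν′≡κ) →
        let ν′≡τ = ⊕-≡-∸ᵉ (μ-bound ν∈g) ν⊕ν′≡κ (GapPattern⇒≤ᵉ lam (shifted-gaps ν′∈h))
        in ν′∈h (≡.subst (λ ν″ → coeff h ν″ ≈ 0#) (≡.sym ν′≡τ) coeff≈0)

lemma3p2 : ∀ {c ℓ : Level} (K : Field c ℓ) (n : ℕ) (lam : Vec ℕ n)
             (f g h : Poly.Polynomial K n) →
             Poly._≈P_ K n f (Poly._*P_ K n g h) →
             (Poly.Lacunary K n lam g → Poly.Lacunary K n lam h → Poly.Lacunary K n lam f)
             × (Poly.Lacunary K n lam f → Poly.Lacunary K n lam g → Poly.Lacunary K n lam h)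
lemma3p2 K n lam f g h f≈gh =
    (λ g-lacunary h-lacunary →
       Lacunary-resp-≈P lam (g *P h) f (sym ∘ f≈gh) (lacunary-*P lam g h g-lacunary h-lacunary))
  , (λ f-lacunary g-lacunary →
       lacunary-cancelˡ lam g h (Lacunary-resp-≈P lam f (g *P h) f≈gh f-lacunary) g-lacunary)
  where
    open Field K using (sym)
    open Poly K n using (_*P_)
    open import Function using (_∘_)
    open Lacunarity K n
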